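{- Let $D$ be an acyclic digraph with a single vertex $s$ of in-degree zero, let $D^*$ be the digraph obtained from $D$ by applying Reduction Rules A and B as long as possible, and let $B$ be the bipartite graph associated with $D^*$ as in the context. If $R\subseteq V'$ is a bidominating set of $B$, then $D^*$ has an out-branching $T$ such that the set of copies in $V'$ of the leaves of $T$ contains $V'\setminus R$.
   Context: An out-tree of a digraph is a subgraph that is an oriented tree with exactly one vertex of in-degree zero (its root); its leaves are the vertices of out-degree zero in it; an out-branching is a spanning out-tree. $d^+(v)$, $d^-(v)$, $N^+(v)$, $N^-(v)$ denote out-degree, in-degree, out-neighbourhood and in-neighbourhood in the current digraph. Reduction Rule A: if the digraph has an arc $xy$ with $d^+(x)=d^-(y)=1$, contract the arc $xy$. Reduction Rule B: if the digraph has an arc $xy$ with $d^+(x)\ge 2$, $d^-(y)=1$ and $x\ne s$, delete $x$ and add the arc $uv$ for each $u\in N^-(x)$ and $v\in N^+(x)$. The bipartite graph $B$ has vertex bipartition $(V',V'')$, where $V'$ is a copy of $V(D^*)$ and $V''$ is a copy of $V(D^*)\setminus\{s\}$, and $u'v''\in E(B)$ (with $u'\in V'$ the copy of $u$ and $v''\in V''$ the copy of $v$) if and only if $uv\in A(D^*)$. A subset $S\subseteq V'$ is a bidominating set of $B$ if every $y\in V''$ has a neighbour in $S$. -}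

module Defs where

open import Data.Bool using (Bool; true; false; _∧_; _∨_; not; if_then_else_)
open import Data.Nat using (ℕ; _≤_)
open import Data.Fin using (Fin)
open import Data.Fin.Properties using (_≟_)
open import Data.List using (List; []; _∷_; _++_; [_]; length; allFin; filterᵇ)
open import Data.Bool.ListAction using (any)
open import Data.List.Relation.Unary.Linked using (Linked)
open import Data.List.Relation.Unary.Unique.Propositional using (Unique)
open import Data.Product using (Σ; ∃; ∃₂; _×_; _,_)
open import Data.Sum using (_⊎_)
open import Relation.Nullary using (¬_; does)
open import Relation.Binary.PropositionalEquality using (_≡_; _≢_)
open import Relation.Binary.Construct.Closure.Transitive using (TransClosure)
open import Relation.Binary.Construct.Closure.ReflexiveTransitive using (Star)

_==_ : ∀ {n} → Fin n → Fin n → Bool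
a == b = does (a ≟ b)

-- A finite simple digraph whose vertices form a subset of Fin n
-- (vertex set `vert`); arcs are given by `adj`, but only arcs between
-- two present vertices count (see `arc`).  Working inside a fixed
-- ambient Fin n lets contraction/deletion keep vertex names.
record Digraph (n : ℕ) : Set where
  field
    vert : Fin n → Bool
    adj  : Fin n → Fin n → Bool
open Digraph public

arc : ∀ {n} → Digraph n → Fin n → Fin n → Bool
arc D u v = vert D u ∧ vert D v ∧ adj D u v

outdeg : ∀ {n} → Digraph n → Fin n → ℕ
outdeg {n} D x = length (filterᵇ (λ v → arc D x v) (allFin n))

indeg : ∀ {n} → Digraph n → Fin n → ℕ
indeg {n} D y = length (filterᵇ (λ u → arc D u y) (allFin n))

-- Contraction of the arc xy: y is merged into x (the merged vertex keeps
-- the name x); arcs incident with y are redirected to x; loops are removed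
-- and parallel arcs are identified (simple digraphs).
contract : ∀ {n} → Digraph n → Fin n → Fin n → Digraph n
contract {n} D x y = record
  { vert = λ v → vert D v ∧ not (v == y)
  ; adj  = λ u v → not (u == v) ∧
             any (λ a → any (λ b → arc D a b ∧ (ren a == u) ∧ (ren b == v))
                            (allFin n)) (allFin n)
  }
  where
  ren : Fin n → Fin n
  ren w = if w == y then x else w

bypass : ∀ {n} → Digraph n → Fin n → Digraph n
bypass D x = record
  { vert = λ v → vert D v ∧ not (v == x)
  ; adj  = λ u v → adj D u v ∨ (arc D u x ∧ arc D x v)
  }

data Step {n} (s : Fin n) (D : Digraph n) : Digraph n → Set where
  ruleA : ∀ x y → arc D x y ≡ true → outdeg D x ≡ 1 → indeg D y ≡ 1 →
          Step s D (contract D x y)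
  ruleB : ∀ x y → arc D x y ≡ true → 2 ≤ outdeg D x → indeg D y ≡ 1 →
          x ≢ s → Step s D (bypass D x)

Reduces : ∀ {n} → Fin n → Digraph n → Digraph n → Set
Reduces s D D* = Star (Step s) D D* × (∀ D′ → ¬ Step s D* D′)

Acyclic : ∀ {n} → Digraph n → Set
Acyclic D = ∀ v → ¬ TransClosure (λ a b → arc D a b ≡ true) v v

UniqueSource : ∀ {n} → Digraph n → Fin n → Set
UniqueSource D s =
  vert D s ≡ true × indeg D s ≡ 0 ×
  (∀ v → vert D v ≡ true → indeg D v ≡ 0 → v ≡ s)

-- The bipartite graph B of D* (copies identified with originals):
-- V' = V(D*), V'' = V(D*) ∖ {s}, and u'v'' ∈ E(B) iff uv ∈ A(D*).
InV′ : ∀ {n} → Digraph n → Fin n → Set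
InV′ D u = vert D u ≡ true

InV″ : ∀ {n} → Digraph n → Fin n → Fin n → Set
InV″ D s v = vert D v ≡ true × v ≢ s

EdgeB : ∀ {n} → Digraph n → Fin n → Fin n → Fin n → Set
EdgeB D s u v = InV′ D u × InV″ D s v × arc D u v ≡ true

Bidominating : ∀ {n} → Digraph n → Fin n → (Fin n → Set) → Set
Bidominating D s S = ∀ y → InV″ D s y → ∃ λ u → S u × EdgeB D s u y

UAdj : ∀ {n} → (Fin n → Fin n → Bool) → Fin n → Fin n → Set
UAdj T u v = T u v ≡ true ⊎ T v u ≡ true

UCycle : ∀ {n} → (Fin n → Fin n → Bool) → Set
UCycle {n} T = ∃₂ λ (v : Fin n) (rest : List (Fin n)) →
  3 ≤ length (v ∷ rest) × Unique (v ∷ rest) ×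
  Linked (UAdj T) (v ∷ rest ++ [ v ])

SpanningOrientedTree : ∀ {n} → Digraph n → (Fin n → Fin n → Bool) → Set
SpanningOrientedTree D T =
  (∀ u v → T u v ≡ true → arc D u v ≡ true) ×
  (∀ u v → T u v ≡ true → T v u ≡ true → u ≡ v) ×
  (∀ u v → vert D u ≡ true → vert D v ≡ true → Star (UAdj T) u v) ×
  ¬ UCycle T

InDegZeroIn : ∀ {n} → (Fin n → Fin n → Bool) → Fin n → Set
InDegZeroIn T v = ∀ u → T u v ≡ false

OutBranching : ∀ {n} → Digraph n → (Fin n → Fin n → Bool) → Set
OutBranching D T =
  SpanningOrientedTree D T ×
  (∃ λ r → vert D r ≡ true × InDegZeroIn T r ×
     (∀ v → vert D v ≡ true → InDegZeroIn T v → v ≡ r))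

IsLeaf : ∀ {n} → Digraph n → (Fin n → Fin n → Bool) → Fin n → Set
IsLeaf D T v = vert D v ≡ true × (∀ w → T v w ≡ false)

-- Both reduction rules only create arcs that stand for directed paths of the
-- old digraph (a contracted arc comes from a → b or x → y → b, a bypass arc from
-- u → x → v), so D* stays acyclic and s stays a vertex without in-arcs.
-- In D*, give every v ∈ V″ the arc from a neighbour in R that dominates it.
-- Following these arcs backwards from any vertex must reach s, for otherwise
-- the pigeonhole principle yields a directed cycle; so they connect D*.
-- Every vertex has at most one in-arc, and then an undirected cycle is
-- impossible: around it the orientation is constant (a directed cycle) or it
-- switches from forward to backward somewhere, where a vertex would get two
-- in-arcs. Only vertices of R have out-arcs, so all others are leaves.
module Submission where

open import Defs
open import Data.Nat using (ℕ; zero; suc; _+_; s≤s)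
open import Data.Nat.Properties using (n<1+n; +-suc; m≤n⇒∃[o]m+o≡n)
open import Data.Nat.GeneralisedArithmetic using (iterate)
open import Data.Fin using (Fin; toℕ)
open import Data.Fin.Properties using (_≟_; pigeonhole)
open import Data.Bool using (Bool; true; false; _∧_; _∨_; not; if_then_else_; T?)
open import Data.Bool.Properties as Bool using (∧-conicalˡ; ∧-conicalʳ; T-≡)
open import Data.Bool.ListAction using (any)
open import Data.List using (List; []; _∷_; _++_; length; allFin; filterᵇ)
open import Data.List.Membership.Propositional using (_∈_; _∉_)
open import Data.List.Membership.Propositional.Properties using (∈-filter⁺; ∈-allFin)
open import Data.List.Relation.Unary.Any using (here; there; satisfied)
open import Data.List.Relation.Unary.Any.Properties using (any⁻)
open import Data.List.Relation.Unary.All as All using (All; _∷_)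
open import Data.List.Relation.Unary.AllPairs using (_∷_)
open import Data.List.Relation.Unary.Linked using (Linked; [-]; _∷_)
open import Data.List.Relation.Unary.Unique.Propositional using (Unique)
open import Data.Product using (Σ; ∃; ∃₂; _×_; _,_; proj₁; proj₂)
open import Data.Sum using (_⊎_; inj₁; inj₂; swap)
open import Data.Unit using (⊤; tt)
open import Data.Empty using (⊥)
open import Function using (flip; _∘_; Equivalence)
open import Relation.Nullary using (¬_; Dec; yes; no; contradiction)
open import Relation.Nullary.Decidable using (_×-dec_; ¬?; dec-true; dec-false; decidable-stable)
open import Relation.Unary using (Decidable)
open import Relation.Binary.PropositionalEquality
  using (_≡_; _≢_; refl; sym; trans; cong; cong₂; subst; ≢-sym; module ≡-Reasoning)
open import Relation.Binary.Construct.Closure.Transitive using (TransClosure; [_]; _∷_; _∷ʳ_)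
  renaming (_++_ to _++⁺_)
open import Relation.Binary.Construct.Closure.ReflexiveTransitive as Star using (Star; ε; _◅_; _◅◅_)

∧-true⁻ : ∀ a {b} → a ∧ b ≡ true → a ≡ true × b ≡ true
∧-true⁻ a h = ∧-conicalˡ a _ h , ∧-conicalʳ a _ h

Edge : ∀ {A : Set} → (A → A → Bool) → A → A → Set
Edge r u v = r u v ≡ true

module _ {n : ℕ} where

  ==⇒≡ : {a b : Fin n} → (a == b) ≡ true → a ≡ b
  ==⇒≡ {a} {b} h with a ≟ b
  ... | yes a≡b = a≡b

  ==-refl : (a : Fin n) → (a == a) ≡ true
  ==-refl a = dec-true (a ≟ a) refl

  ≢⇒==-false : {a b : Fin n} → a ≢ b → (a == b) ≡ false
  ≢⇒==-false {a} {b} = dec-false (a ≟ b)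

  ∈-filterᵇ-allFin : {p : Fin n → Bool} {a : Fin n} → p a ≡ true → a ∈ filterᵇ p (allFin n)
  ∈-filterᵇ-allFin {p} {a} pa = ∈-filter⁺ (T? ∘ p) (∈-allFin a) (Equivalence.from T-≡ pa)

  any-true : ∀ (p : Fin n → Bool) xs → any p xs ≡ true → ∃ λ x → p x ≡ true
  any-true p xs h =
    let x , px = satisfied (any⁻ p xs (Equivalence.from T-≡ h)) in x , Equivalence.to T-≡ px

  any²-allFin-true : ∀ (p : Fin n → Fin n → Bool) →
                     any (λ a → any (p a) (allFin n)) (allFin n) ≡ true → ∃₂ λ a b → p a b ≡ true
  any²-allFin-true p h =
    let a , h′ = any-true _ (allFin n) h
        b , pab = any-true (p a) (allFin n) h′
    in  a , b , pab

length≡0⇒∉ : ∀ {A : Set} {x : A} {xs : List A} → length xs ≡ 0 → x ∉ xs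
length≡0⇒∉ {xs = []} _ ()

length≡1⇒∈-unique : ∀ {A : Set} {x y : A} {xs : List A} → length xs ≡ 1 → x ∈ xs → y ∈ xs → x ≡ y
length≡1⇒∈-unique {xs = _ ∷ []} _ (here refl) (here refl) = refl

module _ {n : ℕ} (D : Digraph n) where

  indeg≡0⇒no-in-arc : ∀ {u v} → indeg D v ≡ 0 → ¬ Edge (arc D) u v
  indeg≡0⇒no-in-arc {v = v} d≡0 uv = length≡0⇒∉ d≡0 (∈-filterᵇ-allFin {p = flip (arc D) v} uv)

  indeg≡1⇒in-arc-unique : ∀ {u u′ v} → indeg D v ≡ 1 →
                          Edge (arc D) u v → Edge (arc D) u′ v → u ≡ u′
  indeg≡1⇒in-arc-unique {v = v} d≡1 uv u′v =
    length≡1⇒∈-unique d≡1 (∈-filterᵇ-allFin {p = flip (arc D) v} uv)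
                          (∈-filterᵇ-allFin {p = flip (arc D) v} u′v)

module _ {A : Set} {R S : A → A → Set} where

  lift⁺ : (∀ {u v} → R u v → TransClosure S u v) →
          ∀ {u v} → TransClosure R u v → TransClosure S u v
  lift⁺ f [ r ]    = f r
  lift⁺ f (r ∷ rs) = f r ++⁺ lift⁺ f rs

module _ {n : ℕ} where

  PathLifting : Digraph n → Digraph n → Set
  PathLifting D′ D = ∀ {u v} → Edge (arc D′) u v → TransClosure (Edge (arc D)) u v

  redirect : Fin n → Fin n → Fin n → Fin n
  redirect y x w = if w == y then x else w

  not-==⇒≢ : {a b : Fin n} → not (a == b) ≡ true → a ≢ b
  not-==⇒≢ {a} h refl = contradiction (trans (sym (cong not (==-refl a))) h) (λ ())

  contract-arc⁻ : ∀ (D : Digraph n) {x y u v} → Edge (arc (contract D x y)) u v →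
                  u ≢ v × ∃₂ λ a b → Edge (arc D) a b × redirect y x a ≡ u × redirect y x b ≡ v
  contract-arc⁻ D {x} {y} {u} {v} h =
    let _ , v-adj = ∧-true⁻ (vert C u) h
        _ , adj-uv = ∧-true⁻ (vert C v) v-adj
        u≠v , some-arc = ∧-true⁻ (not (u == v)) adj-uv
        a , b , ab-uv = any²-allFin-true (λ a b → arc D a b ∧ (ren a == u) ∧ (ren b == v)) some-arc
        ab , redirected = ∧-true⁻ (arc D a b) ab-uv
        a↦u , b↦v = ∧-true⁻ (ren a == u) redirected
    in  not-==⇒≢ u≠v , a , b , ab , ==⇒≡ a↦u , ==⇒≡ b↦v
    where
    ren : Fin n → Fin n
    ren = redirect y x
    C : Digraph n
    C = contract D x y

  redirect-self : ∀ {y x} → redirect y x y ≡ x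
  redirect-self {y} rewrite ==-refl y = refl

  redirect-other : ∀ {y x w} → w ≢ y → redirect y x w ≡ w
  redirect-other w≢y rewrite ≢⇒==-false w≢y = refl

  redirected-arc-lift : ∀ (D : Digraph n) {x y} → Acyclic D → Edge (arc D) x y → indeg D y ≡ 1 →
                        ∀ {a b} → Edge (arc D) a b → redirect y x a ≢ redirect y x b →
                        TransClosure (Edge (arc D)) (redirect y x a) (redirect y x b)
  redirected-arc-lift D {x} {y} acyclic xy y-in {a} {b} ab a≁b = by-cases (b ≟ y) (a ≟ y)
    where
    open ≡-Reasoning
    Lift : Set
    Lift = TransClosure (Edge (arc D)) (redirect y x a) (redirect y x b)
    by-cases : Dec (b ≡ y) → Dec (a ≡ y) → Lift
    by-cases (yes refl) _ = contradiction (begin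
      redirect y x a  ≡⟨ cong (redirect y x) (indeg≡1⇒in-arc-unique D y-in ab xy) ⟩
      redirect y x x  ≡⟨ redirect-other (λ { refl → acyclic x [ xy ] }) ⟩
      x               ≡⟨ redirect-self {y} ⟨
      redirect y x b  ∎) a≁b
    by-cases (no b≢y) (yes refl) rewrite redirect-self {y} {x} | redirect-other {y} {x} b≢y = xy ∷ [ ab ]
    by-cases (no b≢y) (no a≢y) rewrite redirect-other {y} {x} a≢y | redirect-other {y} {x} b≢y = [ ab ]

  contract-pathLifting : ∀ (D : Digraph n) {x y} → Acyclic D → Edge (arc D) x y →
                         indeg D y ≡ 1 → PathLifting (contract D x y) D
  contract-pathLifting D acyclic xy y-in h with contract-arc⁻ D h
  ... | u≢v , a , b , ab , refl , refl = redirected-arc-lift D acyclic xy y-in ab u≢v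

  bypass-pathLifting : ∀ (D : Digraph n) x → PathLifting (bypass D x) D
  bypass-pathLifting D x {u} {v} h =
    let u-kept , v-rest = ∧-true⁻ (vert D u ∧ not (u == x)) h
        v-kept , direct-or-via-x = ∧-true⁻ (vert D v ∧ not (v == x)) v-rest
    in  lift (proj₁ (∧-true⁻ (vert D u) u-kept)) (proj₁ (∧-true⁻ (vert D v) v-kept)) direct-or-via-x
    where
    lift : vert D u ≡ true → vert D v ≡ true → adj D u v ∨ (arc D u x ∧ arc D x v) ≡ true →
           TransClosure (Edge (arc D)) u v
    lift u∈ v∈ h with adj D u v in uv
    ... | true  = [ cong₂ _∧_ u∈ (cong₂ _∧_ v∈ uv) ]
    ... | false = let ux , xv = ∧-true⁻ (arc D u x) h in ux ∷ [ xv ]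

last-step : ∀ {A : Set} {R : A → A → Set} {u v} → TransClosure R u v → ∃ λ w → R w v
last-step [ r ]    = _ , r
last-step (_ ∷ rs) = last-step rs

module _ {n : ℕ} where

  record AcyclicWithSource (s : Fin n) (D : Digraph n) : Set where
    field
      acyclic            : Acyclic D
      source∈            : vert D s ≡ true
      no-arc-into-source : ∀ u → ¬ Edge (arc D) u s
  open AcyclicWithSource

  vertex-kept : ∀ (D : Digraph n) {s z} → vert D s ≡ true → s ≢ z → vert D s ∧ not (s == z) ≡ true
  vertex-kept D s∈ s≢z = cong₂ _∧_ s∈ (cong not (≢⇒==-false s≢z))

  pathLifting-preserves : ∀ {s D D′} → PathLifting D′ D → vert D′ s ≡ true →
                          AcyclicWithSource s D → AcyclicWithSource s D′
  pathLifting-preserves lift s∈ inv = record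
    { acyclic            = λ v cycle → acyclic inv v (lift⁺ lift cycle)
    ; source∈            = s∈
    ; no-arc-into-source = λ u us → let w , ws = last-step (lift us) in no-arc-into-source inv w ws
    }

  step-preserves : ∀ {s D D′} → Step s D D′ → AcyclicWithSource s D → AcyclicWithSource s D′
  step-preserves {D = D} (ruleA x y xy _ y-in) inv =
    pathLifting-preserves (contract-pathLifting D (acyclic inv) xy y-in)
                          (vertex-kept D (source∈ inv) λ { refl → no-arc-into-source inv x xy }) inv
  step-preserves {D = D} (ruleB x _ _ _ _ x≢s) inv =
    pathLifting-preserves (bypass-pathLifting D x) (vertex-kept D (source∈ inv) (≢-sym x≢s)) inv

  reduction-preserves : ∀ {s D D′} → Star (Step s) D D′ → AcyclicWithSource s D → AcyclicWithSource s D′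
  reduction-preserves ε            inv = inv
  reduction-preserves (step ◅ steps) inv = reduction-preserves steps (step-preserves step inv)

linked⇒plus : ∀ {A : Set} {R : A → A → Set} x ys z → Linked R (x ∷ ys ++ z ∷ []) → TransClosure R x z
linked⇒plus x []       z (r ∷ [-])  = [ r ]
linked⇒plus x (y ∷ ys) z (r ∷ rs) = r ∷ linked⇒plus y ys z rs

plus-flip : ∀ {A : Set} {R : A → A → Set} {x y} → TransClosure (flip R) x y → TransClosure R y x
plus-flip [ r ]    = [ r ]
plus-flip (r ∷ rs) = plus-flip rs ∷ʳ r

module _ {A : Set} where

  NonBacktracking : List A → Set
  NonBacktracking (x ∷ y ∷ z ∷ zs) = x ≢ z × NonBacktracking (y ∷ z ∷ zs)
  NonBacktracking _                = ⊤

  unique⇒nonBacktracking : ∀ xs {z : A} → Unique xs → All (_≢ z) xs → NonBacktracking (xs ++ z ∷ [])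
  unique⇒nonBacktracking []               _                     _              = tt
  unique⇒nonBacktracking (x ∷ [])         _                     _              = tt
  unique⇒nonBacktracking (x ∷ y ∷ [])     _                     (x≢z ∷ _)      = x≢z , tt
  unique⇒nonBacktracking (x ∷ y ∷ w ∷ ws) ((_ ∷ x≢w ∷ _) ∷ uniq) (_ ∷ ys≢z) =
    x≢w , unique⇒nonBacktracking (y ∷ w ∷ ws) uniq ys≢z

  closedWalk-nonBacktracking : ∀ v x y ys → Unique (v ∷ x ∷ y ∷ ys) →
                               NonBacktracking (v ∷ x ∷ y ∷ ys ++ v ∷ [])
  closedWalk-nonBacktracking v x y ys (v∉ ∷ uniq) =
    All.head (All.tail v∉) , unique⇒nonBacktracking (x ∷ y ∷ ys) uniq (All.map ≢-sym v∉)

  LastStep : (A → A → Set) → List A → Set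
  LastStep R (x ∷ y ∷ [])     = R x y
  LastStep R (_ ∷ y ∷ z ∷ zs) = LastStep R (y ∷ z ∷ zs)
  LastStep R _                = ⊥

  module _ {R : A → A → Set} where

    linked⇒lastStep : ∀ x y ys → Linked R (x ∷ y ∷ ys) → LastStep R (x ∷ y ∷ ys)
    linked⇒lastStep x y []       (r ∷ [-])  = r
    linked⇒lastStep x y (z ∷ zs) (_ ∷ rs) = linked⇒lastStep y z zs rs

    lastStep-from : ∀ x y ys z → LastStep R (x ∷ y ∷ ys ++ z ∷ []) → ∃ λ w → w ∈ y ∷ ys × R w z
    lastStep-from x y []        z r = y , here refl , r
    lastStep-from x y (y′ ∷ ys) z r with lastStep-from y y′ ys z r
    ... | w , w∈ , wz = w , there w∈ , wz

module _ {A : Set} (_⇀_ : A → A → Set) where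

  data Orientation (x y : A) (ys : List A) : Set where
    forward  : Linked _⇀_ (x ∷ y ∷ ys) → Orientation x y ys
    backward : Linked (flip _⇀_) (x ∷ y ∷ ys) → Orientation x y ys
    turning  : y ⇀ x → LastStep _⇀_ (x ∷ y ∷ ys) → Orientation x y ys

module _ {A : Set} {_⇀_ : A → A → Set} (in-functional : ∀ {u u′ v} → u ⇀ v → u′ ⇀ v → u ≡ u′) where

  walk-orientation : ∀ x y ys → Linked (λ u v → u ⇀ v ⊎ v ⇀ u) (x ∷ y ∷ ys) →
                     NonBacktracking (x ∷ y ∷ ys) → Orientation _⇀_ x y ys
  walk-orientation x y []       (inj₁ xy ∷ [-]) _ = forward (xy ∷ [-])
  walk-orientation x y []       (inj₂ yx ∷ [-]) _ = backward (yx ∷ [-])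
  walk-orientation x y (z ∷ zs) (step ∷ walk) (x≢z , nb) with walk-orientation y z zs walk nb | step
  ... | forward yz⋯        | inj₁ xy = forward (xy ∷ yz⋯)
  ... | forward yz⋯        | inj₂ yx = turning yx (linked⇒lastStep y z zs yz⋯)
  ... | backward zy⋯       | inj₂ yx = backward (yx ∷ zy⋯)
  ... | turning _ last     | inj₂ yx = turning yx last
  -- x → y ← z with x ≢ z would give y two in-neighbours
  ... | backward (zy ∷ _)  | inj₁ xy = contradiction (in-functional xy zy) x≢z
  ... | turning zy _       | inj₁ xy = contradiction (in-functional xy zy) x≢z

module _ {n : ℕ} {T : Fin n → Fin n → Bool}
         (acyclicT : ∀ v → ¬ TransClosure (Edge T) v v)
         (in-functional : ∀ {u u′ v} → Edge T u v → Edge T u′ v → u ≡ u′) where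

  no-undirected-cycle : ¬ UCycle T
  no-undirected-cycle (_ , []     , s≤s () , _)
  no-undirected-cycle (_ , _ ∷ [] , s≤s (s≤s ()) , _)
  no-undirected-cycle (v , r₁ ∷ r₂ ∷ rs , _ , v∉ ∷ uniq@(r₁∉ ∷ _) , walk)
    with walk-orientation in-functional v r₁ (r₂ ∷ rs ++ v ∷ []) walk
                          (closedWalk-nonBacktracking v r₁ r₂ rs (v∉ ∷ uniq))
  ... | forward cycle  = acyclicT v (linked⇒plus v (r₁ ∷ r₂ ∷ rs) v cycle)
  ... | backward cycle = acyclicT v (plus-flip (linked⇒plus v (r₁ ∷ r₂ ∷ rs) v cycle))
  -- v would have the in-neighbours r₁ and a later vertex of the cycle
  ... | turning r₁v last with lastStep-from r₁ r₂ rs v last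
  ...   | w , w∈ , wv = All.lookup r₁∉ w∈ (in-functional r₁v wv)

iterate-+ : ∀ {A : Set} (f : A → A) x m k → iterate f x (m + k) ≡ iterate f (iterate f x m) k
iterate-+ f x zero    k = refl
iterate-+ f x (suc m) k = iterate-+ f (f x) m k

module _ {n : ℕ} {_⟶_ : Fin n → Fin n → Set}
         (acyclic⟶ : ∀ v → ¬ TransClosure _⟶_ v v)
         {V : Fin n → Set} (V? : Decidable V) (r : Fin n)
         (has-in-neighbour : ∀ {v} → V v → v ≢ r → ∃ λ u → V u × u ⟶ v) where

  private
    parent : Fin n → Fin n
    parent v with V? v ×-dec ¬? (v ≟ r)
    ... | yes (v∈ , v≢r) = proj₁ (has-in-neighbour v∈ v≢r)
    ... | no _           = v

    parent-spec : ∀ {v} → V v → (v ≡ r × parent v ≡ v) ⊎ (v ≢ r × V (parent v) × parent v ⟶ v)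
    parent-spec {v} v∈ with V? v ×-dec ¬? (v ≟ r)
    ... | yes (v∈′ , v≢r) = inj₂ (v≢r , proj₂ (has-in-neighbour v∈′ v≢r))
    ... | no ¬v∈∧v≢r with v ≟ r
    ...   | yes v≡r = inj₁ (v≡r , refl)
    ...   | no v≢r  = contradiction (v∈ , v≢r) ¬v∈∧v≢r

    parent-step : ∀ {v} → V v → V (parent v) × Star _⟶_ (parent v) v
    parent-step v∈ with parent-spec v∈
    ... | inj₁ (_ , fixed)    = subst (λ u → V u × Star _⟶_ u _) (sym fixed) (v∈ , ε)
    ... | inj₂ (_ , p∈ , pv) = p∈ , pv ◅ ε

    ancestor-path : ∀ k {v} → V v → V (iterate parent v k) × Star _⟶_ (iterate parent v k) v
    ancestor-path zero    v∈ = v∈ , ε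
    ancestor-path (suc k) v∈ =
      let p∈ , pv = parent-step v∈
          a∈ , ap = ancestor-path k p∈
      in  a∈ , ap ◅◅ pv

    root-or-cycle : ∀ k {w} → V w →
                    (∃ λ j → iterate parent w j ≡ r) ⊎ TransClosure _⟶_ (iterate parent w (suc k)) w
    root-or-cycle k w∈ with parent-spec w∈
    root-or-cycle k       w∈ | inj₁ (w≡r , _)    = inj₁ (0 , w≡r)
    root-or-cycle zero    w∈ | inj₂ (_ , _ , pw)  = inj₂ [ pw ]
    root-or-cycle (suc k) w∈ | inj₂ (_ , p∈ , pw) with root-or-cycle k p∈
    ... | inj₁ (j , reached) = inj₁ (suc j , reached)
    ... | inj₂ cycle         = inj₂ (cycle ∷ʳ pw)

    iterate-reaches-root : ∀ {v} → V v → ∃ λ k → iterate parent v k ≡ r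
    iterate-reaches-root {v} v∈
      with i , j , i<j , same ← pigeonhole (n<1+n n) (λ (i : Fin (suc n)) → iterate parent v (toℕ i))
      with d , i+1+d≡j ← m≤n⇒∃[o]m+o≡n i<j
      with root-or-cycle d (proj₁ (ancestor-path (toℕ i) v∈))
    ... | inj₁ (k , reached) = toℕ i + k , trans (iterate-+ parent v (toℕ i) k) reached
    ... | inj₂ cycle = contradiction (subst (λ u → TransClosure _⟶_ u _) returns cycle) (acyclic⟶ _)
      where
      open ≡-Reasoning
      i+1+d≡j′ : toℕ i + suc d ≡ toℕ j
      i+1+d≡j′ = trans (+-suc (toℕ i) d) i+1+d≡j
      returns : iterate parent (iterate parent v (toℕ i)) (suc d) ≡ iterate parent v (toℕ i)
      returns = begin
        iterate parent (iterate parent v (toℕ i)) (suc d)  ≡⟨ iterate-+ parent v (toℕ i) (suc d) ⟨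
        iterate parent v (toℕ i + suc d)                   ≡⟨ cong (iterate parent v) i+1+d≡j′ ⟩
        iterate parent v (toℕ j)                           ≡⟨ same ⟨
        iterate parent v (toℕ i)                           ∎

  reachable-from-root : ∀ {v} → V v → Star _⟶_ r v
  reachable-from-root {v} v∈ =
    let k , reached = iterate-reaches-root v∈
    in  subst (λ u → Star _⟶_ u v) reached (proj₂ (ancestor-path k v∈))

module _ {n : ℕ} (E : Digraph n) (s : Fin n) {R : Fin n → Set} (bidominating : Bidominating E s R) where

  InV″? : Decidable (InV″ E s)
  InV″? v = (vert E v Bool.≟ true) ×-dec ¬? (v ≟ s)

  dominatorBranching : Fin n → Fin n → Bool
  dominatorBranching u v with InV″? v
  ... | yes v∈ = u == proj₁ (bidominating v v∈)
  ... | no _   = false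

  private
    T : Fin n → Fin n → Bool
    T = dominatorBranching

  dominatorBranching-arc : ∀ {u v} → Edge T u v → R u × Edge (arc E) u v
  dominatorBranching-arc {u} {v} h with InV″? v
  ... | yes v∈ with refl ← ==⇒≡ {a = u} {b = proj₁ (bidominating v v∈)} h =
    let _ , Ru , _ , _ , uv = bidominating v v∈ in Ru , uv

  dominatorBranching-in-functional : ∀ {u u′ v} → Edge T u v → Edge T u′ v → u ≡ u′
  dominatorBranching-in-functional {v = v} h h′ with InV″? v
  ... | yes _ = trans (==⇒≡ h) (sym (==⇒≡ h′))

  dominatorBranching-in-neighbour : ∀ {v} → InV″ E s v → ∃ λ u → vert E u ≡ true × Edge T u v
  dominatorBranching-in-neighbour {v} v∈ with InV″? v
  ... | yes v∈′ = let u , _ , u∈ , _ = bidominating v v∈′ in u , u∈ , ==-refl u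
  ... | no v∉   = contradiction v∈ v∉

  dominatorBranching-root : InDegZeroIn T s
  dominatorBranching-root u with InV″? s
  ... | yes (_ , s≢s) = contradiction refl s≢s
  ... | no _          = refl

  module _ (acyclic : Acyclic E) where

    dominatorBranching-acyclic : ∀ v → ¬ TransClosure (Edge T) v v
    dominatorBranching-acyclic v = acyclic v ∘ lift⁺ ([_] ∘ proj₂ ∘ dominatorBranching-arc)

    dominatorBranching-reaches : ∀ {v} → vert E v ≡ true → Star (Edge T) s v
    dominatorBranching-reaches =
      reachable-from-root dominatorBranching-acyclic (λ v → vert E v Bool.≟ true) s
        (λ v∈ v≢s → dominatorBranching-in-neighbour (v∈ , v≢s))

    dominatorBranching-outBranching : vert E s ≡ true → OutBranching E T
    dominatorBranching-outBranching s∈ =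
      ( (λ _ _ → proj₂ ∘ dominatorBranching-arc)
      , (λ u _ uv vu → contradiction (uv ∷ [ vu ]) (dominatorBranching-acyclic u))
      , (λ _ _ u∈ v∈ → Star.reverse swap (tree-path u∈) ◅◅ tree-path v∈)
      , no-undirected-cycle dominatorBranching-acyclic dominatorBranching-in-functional )
      , s , s∈ , dominatorBranching-root , unique-root
      where
      tree-path : ∀ {v} → vert E v ≡ true → Star (UAdj T) s v
      tree-path = Star.map inj₁ ∘ dominatorBranching-reaches
      unique-root : ∀ v → vert E v ≡ true → InDegZeroIn T v → v ≡ s
      unique-root v v∈ no-in = decidable-stable (v ≟ s) λ v≢s →
        let u , _ , uv = dominatorBranching-in-neighbour (v∈ , v≢s)
        in  contradiction (trans (sym uv) (no-in u)) λ ()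

  dominatorBranching-leaves : ∀ v → vert E v ≡ true → ¬ R v → IsLeaf E T v
  dominatorBranching-leaves v v∈ ¬Rv = v∈ , λ w → Bool.¬-not (¬Rv ∘ proj₁ ∘ dominatorBranching-arc)

lemma9 : (n : ℕ) (D D* : Digraph n) (s : Fin n) →
    Acyclic D → UniqueSource D s → Reduces s D D* →
    (R : Fin n → Set) → (∀ u → R u → InV′ D* u) → Bidominating D* s R →
    Σ (Fin n → Fin n → Bool) λ T →
    OutBranching D* T × (∀ v → InV′ D* v → ¬ R v → IsLeaf D* T v)
lemma9 n D D* s acyclicD (s∈ , s-indeg≡0 , _) (reduction , _) R _ bidominating =
    dominatorBranching D* s bidominating
  , dominatorBranching-outBranching D* s bidominating (acyclic reduced) (source∈ reduced)
  , dominatorBranching-leaves D* s bidominating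
  where
  open AcyclicWithSource
  reduced : AcyclicWithSource s D*
  reduced = reduction-preserves reduction record
    { acyclic            = acyclicD
    ; source∈            = s∈
    ; no-arc-into-source = λ _ → indeg≡0⇒no-in-arc D s-indeg≡0
    }
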